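{- Let $\varphi$ be a closed formula (as defined in the context). If $\{\mathit{sys}\}\vdash\varphi:\oplus$ is derivable in the inference system below, then $\varphi$ is $\oplus$-monotone; if $\{\mathit{sys}\}\vdash\varphi:\ominus$ is derivable, then $\varphi$ is $\ominus$-monotone.
   Context: Fix a finite set $AP$ of atomic propositions and $\Sigma := 2^{AP}$. Let $\mathcal{V}$ be a set of trace variables and $\mathcal{W}$ a set of set variables containing a special variable $\mathit{sys}$. Formulas are given by $\varphi ::= a_\pi \mid \neg\varphi \mid \varphi\wedge\varphi \mid \mathsf{X}\varphi \mid \mathsf{Y}\varphi \mid \varphi\,\mathsf{U}\,\varphi \mid \varphi\,\mathsf{S}\,\varphi \mid \mathbb{Q}\pi\in X.\varphi \mid \mathbb{Q}X.\varphi \mid \mathit{fix}(X,\xi_1,\dots,\xi_k).\varphi$, with $a\in AP$, $\pi\in\mathcal{V}$, $X\in\mathcal{W}$, $\mathbb{Q}\in\{\forall,\exists\}$, where each $\xi_j$ has the form $\forall \pi_1\in X_1\ldots\forall\pi_n\in X_n.\ \varphi_{\mathit{step}}\to\pi\in X$ with $\varphi_{\mathit{step}}$ quantifier-free (trace variables in $\varphi_{step}$ and $\pi$ are among $\pi_1,\dots,\pi_n$ or bound outside; each $X_l$ is $X$ or bound outside). Semantics: for a trace length $m$ and a set $\mathbb{T}\subseteq\Sigma^m$, with trace assignment $\Pi:\mathcal{V}\rightharpoonup\Sigma^m$, set assignment $\Delta:\mathcal{W}\rightharpoonup 2^{\Sigma^m}$ and position $i$: $a_\pi$ holds iff $a\in\Pi(\pi)(i)$;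 Boolean connectives as usual; $\mathsf{X}\varphi$ iff $i<m-1$ and $\varphi$ holds at $i+1$; $\mathsf{Y}\varphi$ iff $i>0$ and $\varphi$ holds at $i-1$; $\varphi_1\mathsf{U}\varphi_2$ iff there is $i\le j<m$ with $\varphi_2$ at $j$ and $\varphi_1$ at all $i\le k<j$; $\varphi_1\mathsf{S}\varphi_2$ iff there is $j\le i$ with $\varphi_2$ at $j$ and $\varphi_1$ at all $j<k\le i$; $\mathbb{Q}\pi\in X.\varphi$ iff $\mathbb{Q}t\in\Delta(X)$, $\varphi$ holds under $\Pi[\pi\mapsto t]$; $\mathbb{Q}X.\varphi$ iff $\mathbb{Q}A\subseteq\mathbb{T}$, $\varphi$ holds under $\Delta[X\mapsto A]$; $\mathit{fix}(X,\xi_1,\dots,\xi_k).\varphi$ iff $\varphi$ holds under $\Delta[X\mapsto S]$ where $S$ is the smallest set of traces such that every $\xi_j$ holds under $\Delta[X\mapsto S]$ (at the same $\Pi$, $i$). $\mathbb{T}\models\varphi$ iff $\varphi$ holds with $\Pi=\emptyset$, $\Delta=[\mathit{sys}\mapsto\mathbb{T}]$, $i=0$. The formula $\varphi$ is $\oplus$-monotone (resp. $\ominus$-monotone) if for every $m$ and all $\mathbb{T}\subseteq\mathbb{T}'\subseteq\Sigma^m$, $\mathbb{T}\models\varphi$ implies $\mathbb{T}'\models\varphi$ (resp. $\mathbb{T}\not\models\varphi$ implies $\mathbb{T}'\not\models\varphi$). Inference system: judgments $\Gamma\vdash\varphi:\alpha$ with $\Gamma\subseteq\mathcal{W}$ finite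 and $\alpha\in\{\oplus,\ominus\}$; rules: $\Gamma\vdash a_\pi:\oplus$ and $\Gamma\vdash a_\pi:\ominus$ (axioms); from $\Gamma\vdash\varphi:\oplus$ infer $\Gamma\vdash\neg\varphi:\ominus$; from $\Gamma\vdash\varphi:\ominus$ infer $\Gamma\vdash\neg\varphi:\oplus$; for $\circ\in\{\mathsf{X},\mathsf{Y}\}$, from $\Gamma\vdash\varphi:\alpha$ infer $\Gamma\vdash\circ\varphi:\alpha$; for $\circ\in\{\wedge,\mathsf{U},\mathsf{S}\}$, from $\Gamma\vdash\varphi_1:\alpha$ and $\Gamma\vdash\varphi_2:\alpha$ infer $\Gamma\vdash\varphi_1\circ\varphi_2:\alpha$; if $X\in\Gamma$ and $\Gamma\vdash\varphi:\oplus$ infer $\Gamma\vdash\exists\pi\in X.\varphi:\oplus$; if $X\in\Gamma$ and $\Gamma\vdash\varphi:\ominus$ infer $\Gamma\vdash\forall\pi\in X.\varphi:\ominus$; from $\Gamma\cup\{X\}\vdash\varphi:\alpha$ infer $\Gamma\vdash\mathit{fix}(X,\xi_1,\dots,\xi_k).\varphi:\alpha$; from $\Gamma\vdash\varphi:\alpha$ infer $\Gamma\vdash\mathbb{Q}X.\varphi:\alpha$ for $\mathbb{Q}\in\{\forall,\exists\}$. -}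

module Defs where

open import Level using (Level; Lift; lift) renaming (suc to lsuc; zero to lzero)
open import Data.Nat using (ℕ; zero; suc; _≤_; _<_; _≟_)
open import Data.Fin using (Fin; fromℕ<)
open import Data.Fin.Subset using (Subset; _∈_)
open import Data.List using (List; []; _∷_; _++_; map)
open import Data.List.Relation.Unary.All using (All)
open import Data.List.Membership.Propositional renaming (_∈_ to _∈ₗ_)
open import Data.Maybe using (Maybe; just; nothing)
open import Data.Product using (Σ; _×_; _,_; proj₁; ∃-syntax)
open import Data.Empty using (⊥)
open import Data.Bool using (if_then_else_)
open import Relation.Nullary using (¬_)
open import Relation.Nullary.Decidable using (⌊_⌋)
open import Relation.Binary.PropositionalEquality using (_≡_)

-- Conventions.
-- AP = Fin k (a finite set of k atomic propositions); Σ = 2^AP = Subset k.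
-- Trace variables 𝒱 = ℕ and set variables 𝒲 = ℕ; the special set
-- variable sys is 0.

TVar : Set
TVar = ℕ

SVar : Set
SVar = ℕ

sys : SVar
sys = 0

data Quant : Set where
  ∀q ∃q : Quant

data QF (k : ℕ) : Set where
  atomQ  : Fin k → TVar → QF k
  notQ   : QF k → QF k
  andQ   : QF k → QF k → QF k
  nextQ  : QF k → QF k
  prevQ  : QF k → QF k
  untilQ : QF k → QF k → QF k
  sinceQ : QF k → QF k → QF k

-- A clause ξ = ∀π₁∈X₁ … ∀πₙ∈Xₙ. φ_step → π ∈ X   (X = the fix variable)
record Clause (k : ℕ) : Set where
  constructor clause
  field
    binders : List (TVar × SVar)
    step    : QF k
    target  : TVar

data Formula (k : ℕ) : Set where
  atom   : Fin k → TVar → Formula k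
  ¬'_    : Formula k → Formula k
  _∧'_   : Formula k → Formula k → Formula k
  X'_    : Formula k → Formula k
  Y'_    : Formula k → Formula k
  _U'_   : Formula k → Formula k → Formula k
  _S'_   : Formula k → Formula k → Formula k
  qtrace : Quant → TVar → SVar → Formula k → Formula k
  qset   : Quant → SVar → Formula k → Formula k
  fix    : SVar → List (Clause k) → Formula k → Formula k

data ScopedQF {k : ℕ} (tv : List TVar) : QF k → Set where
  atomQ  : ∀ {a π} → π ∈ₗ tv → ScopedQF tv (atomQ a π)
  notQ   : ∀ {φ} → ScopedQF tv φ → ScopedQF tv (notQ φ)
  andQ   : ∀ {φ ψ} → ScopedQF tv φ → ScopedQF tv ψ → ScopedQF tv (andQ φ ψ)
  nextQ  : ∀ {φ} → ScopedQF tv φ → ScopedQF tv (nextQ φ)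
  prevQ  : ∀ {φ} → ScopedQF tv φ → ScopedQF tv (prevQ φ)
  untilQ : ∀ {φ ψ} → ScopedQF tv φ → ScopedQF tv ψ → ScopedQF tv (untilQ φ ψ)
  sinceQ : ∀ {φ ψ} → ScopedQF tv φ → ScopedQF tv ψ → ScopedQF tv (sinceQ φ ψ)

data ScopedBinders {k : ℕ} (X : SVar) (sv : List SVar) :
       List TVar → List (TVar × SVar) → QF k → TVar → Set where
  done : ∀ {tv φ π} → ScopedQF tv φ → π ∈ₗ tv →
         ScopedBinders X sv tv [] φ π
  bind : ∀ {tv πₗ Xₗ bs φ π} → Xₗ ∈ₗ (X ∷ sv) →
         ScopedBinders X sv (πₗ ∷ tv) bs φ π →
         ScopedBinders X sv tv ((πₗ , Xₗ) ∷ bs) φ π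

ScopedClause : {k : ℕ} → SVar → List TVar → List SVar → Clause k → Set
ScopedClause X tv sv ξ =
  ScopedBinders X sv tv (Clause.binders ξ) (Clause.step ξ) (Clause.target ξ)

data Scoped {k : ℕ} (tv : List TVar) (sv : List SVar) : Formula k → Set where
  atom   : ∀ {a π} → π ∈ₗ tv → Scoped tv sv (atom a π)
  ¬'_    : ∀ {φ} → Scoped tv sv φ → Scoped tv sv (¬' φ)
  _∧'_   : ∀ {φ ψ} → Scoped tv sv φ → Scoped tv sv ψ → Scoped tv sv (φ ∧' ψ)
  X'_    : ∀ {φ} → Scoped tv sv φ → Scoped tv sv (X' φ)
  Y'_    : ∀ {φ} → Scoped tv sv φ → Scoped tv sv (Y' φ)
  _U'_   : ∀ {φ ψ} → Scoped tv sv φ → Scoped tv sv ψ → Scoped tv sv (φ U' ψ)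
  _S'_   : ∀ {φ ψ} → Scoped tv sv φ → Scoped tv sv ψ → Scoped tv sv (φ S' ψ)
  qtrace : ∀ {Q π X φ} → X ∈ₗ sv → Scoped (π ∷ tv) sv φ →
           Scoped tv sv (qtrace Q π X φ)
  qset   : ∀ {Q X φ} → Scoped tv (X ∷ sv) φ → Scoped tv sv (qset Q X φ)
  fix    : ∀ {X ξs φ} → All (ScopedClause X tv sv) ξs →
           Scoped tv (X ∷ sv) φ → Scoped tv sv (fix X ξs φ)

Closed : {k : ℕ} → Formula k → Set
Closed φ = Scoped [] (sys ∷ []) φ

Trace : ℕ → ℕ → Set
Trace k m = Fin m → Subset k

TSet : ℕ → ℕ → Set₁
TSet k m = Trace k m → Set

_⊆ₜ_ : ∀ {k m} → TSet k m → TSet k m → Set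
A ⊆ₜ B = ∀ t → A t → B t

TAssign : ℕ → ℕ → Set
TAssign k m = TVar → Maybe (Trace k m)

-- set assignment (unassigned variables denote the empty set; irrelevant
-- for closed formulas)
SAssign : ℕ → ℕ → Set₁
SAssign k m = SVar → TSet k m

_[_↦ₜ_] : ∀ {k m} → TAssign k m → TVar → Trace k m → TAssign k m
(Π [ π ↦ₜ t ]) ρ = if ⌊ ρ ≟ π ⌋ then just t else Π ρ

_[_↦ₛ_] : ∀ {k m} → SAssign k m → SVar → TSet k m → SAssign k m
(Δ [ X ↦ₛ A ]) Y = if ⌊ Y ≟ X ⌋ then A else Δ Y

AtomHolds : ∀ {k m} → Fin k → Maybe (Trace k m) → ℕ → Set
AtomHolds a nothing  i = ⊥
AtomHolds {m = m} a (just t) i = Σ (i < m) λ i<m → a ∈ t (fromℕ< i<m)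

InSet : ∀ {k m} → Maybe (Trace k m) → TSet k m → Set
InSet nothing  A = ⊥
InSet (just t) A = A t

⟦_⟧q : ∀ {k m} → QF k → TAssign k m → ℕ → Set
⟦ atomQ a π ⟧q Π i = AtomHolds a (Π π) i
⟦ notQ φ ⟧q Π i = ¬ ⟦ φ ⟧q Π i
⟦ andQ φ ψ ⟧q Π i = ⟦ φ ⟧q Π i × ⟦ ψ ⟧q Π i
⟦_⟧q {m = m} (nextQ φ) Π i = suc i < m × ⟦ φ ⟧q Π (suc i)
⟦ prevQ φ ⟧q Π zero = ⊥
⟦ prevQ φ ⟧q Π (suc i) = ⟦ φ ⟧q Π i
⟦_⟧q {m = m} (untilQ φ ψ) Π i =
  ∃[ j ] (i ≤ j × j < m × ⟦ ψ ⟧q Π j × (∀ l → i ≤ l → l < j → ⟦ φ ⟧q Π l))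
⟦ sinceQ φ ψ ⟧q Π i =
  ∃[ j ] (j ≤ i × ⟦ ψ ⟧q Π j × (∀ l → j < l → l ≤ i → ⟦ φ ⟧q Π l))

-- ∀π₁∈X₁ … ∀πₙ∈Xₙ. φ_step → π ∈ X, under Δ (with X already bound in Δ)
BindersHold : ∀ {k m} → SVar → List (TVar × SVar) → QF k → TVar →
              TAssign k m → SAssign k m → ℕ → Set
BindersHold X [] φ π Π Δ i = ⟦ φ ⟧q Π i → InSet (Π π) (Δ X)
BindersHold X ((πₗ , Xₗ) ∷ bs) φ π Π Δ i =
  ∀ t → Δ Xₗ t → BindersHold X bs φ π (Π [ πₗ ↦ₜ t ]) Δ i

ClauseHolds : ∀ {k m} → SVar → Clause k → TAssign k m → SAssign k m → ℕ → Set
ClauseHolds X ξ = BindersHold X (Clause.binders ξ) (Clause.step ξ) (Clause.target ξ)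

AllClausesHold : ∀ {k m} → SVar → List (Clause k) → TAssign k m →
                 SAssign k m → ℕ → Set
AllClausesHold X ξs Π Δ i = All (λ ξ → ClauseHolds X ξ Π Δ i) ξs

⟦_⟧ : ∀ {k m} → Formula k → TSet k m → TAssign k m → SAssign k m → ℕ → Set₁
⟦ atom a π ⟧ 𝕋 Π Δ i = Lift (lsuc lzero) (AtomHolds a (Π π) i)
⟦ ¬' φ ⟧ 𝕋 Π Δ i = ¬ ⟦ φ ⟧ 𝕋 Π Δ i
⟦ φ ∧' ψ ⟧ 𝕋 Π Δ i = ⟦ φ ⟧ 𝕋 Π Δ i × ⟦ ψ ⟧ 𝕋 Π Δ i
⟦_⟧ {m = m} (X' φ) 𝕋 Π Δ i = Lift (lsuc lzero) (suc i < m) × ⟦ φ ⟧ 𝕋 Π Δ (suc i)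
⟦ Y' φ ⟧ 𝕋 Π Δ zero = Lift (lsuc lzero) ⊥
⟦ Y' φ ⟧ 𝕋 Π Δ (suc i) = ⟦ φ ⟧ 𝕋 Π Δ i
⟦_⟧ {m = m} (φ U' ψ) 𝕋 Π Δ i =
  ∃[ j ] (Lift (lsuc lzero) (i ≤ j × j < m) × ⟦ ψ ⟧ 𝕋 Π Δ j ×
          (∀ l → i ≤ l → l < j → ⟦ φ ⟧ 𝕋 Π Δ l))
⟦ φ S' ψ ⟧ 𝕋 Π Δ i =
  ∃[ j ] (Lift (lsuc lzero) (j ≤ i) × ⟦ ψ ⟧ 𝕋 Π Δ j ×
          (∀ l → j < l → l ≤ i → ⟦ φ ⟧ 𝕋 Π Δ l))
⟦ qtrace ∀q π X φ ⟧ 𝕋 Π Δ i = ∀ t → Δ X t → ⟦ φ ⟧ 𝕋 (Π [ π ↦ₜ t ]) Δ i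
⟦ qtrace ∃q π X φ ⟧ 𝕋 Π Δ i = ∃[ t ] (Lift (lsuc lzero) (Δ X t) × ⟦ φ ⟧ 𝕋 (Π [ π ↦ₜ t ]) Δ i)
⟦ qset ∀q X φ ⟧ 𝕋 Π Δ i = ∀ A → A ⊆ₜ 𝕋 → ⟦ φ ⟧ 𝕋 Π (Δ [ X ↦ₛ A ]) i
⟦ qset ∃q X φ ⟧ 𝕋 Π Δ i = ∃[ A ] (Lift (lsuc lzero) (A ⊆ₜ 𝕋) × ⟦ φ ⟧ 𝕋 Π (Δ [ X ↦ₛ A ]) i)
⟦ fix X ξs φ ⟧ 𝕋 Π Δ i =
  ∃[ S ] ( Lift (lsuc lzero) (AllClausesHold X ξs Π (Δ [ X ↦ₛ S ]) i)
         × (∀ A → AllClausesHold X ξs Π (Δ [ X ↦ₛ A ]) i → Lift (lsuc lzero) (S ⊆ₜ A))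
         × ⟦ φ ⟧ 𝕋 Π (Δ [ X ↦ₛ S ]) i)

_⊨_ : ∀ {k m} → TSet k m → Formula k → Set₁
𝕋 ⊨ φ = ⟦ φ ⟧ 𝕋 (λ _ → nothing) ((λ _ _ → ⊥) [ sys ↦ₛ 𝕋 ]) 0

⊕-monotone : ∀ {k} → Formula k → Set₁
⊕-monotone {k} φ = ∀ m (𝕋 𝕋' : TSet k m) → 𝕋 ⊆ₜ 𝕋' → 𝕋 ⊨ φ → 𝕋' ⊨ φ

⊖-monotone : ∀ {k} → Formula k → Set₁
⊖-monotone {k} φ = ∀ m (𝕋 𝕋' : TSet k m) → 𝕋 ⊆ₜ 𝕋' → ¬ (𝕋 ⊨ φ) → ¬ (𝕋' ⊨ φ)

data Pol : Set where
  ⊕ ⊖ : Pol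

data _⊢_∶_ {k : ℕ} (Γ : List SVar) : Formula k → Pol → Set where
  atom⊕ : ∀ {a π} → Γ ⊢ atom a π ∶ ⊕
  atom⊖ : ∀ {a π} → Γ ⊢ atom a π ∶ ⊖
  neg⊕  : ∀ {φ} → Γ ⊢ φ ∶ ⊕ → Γ ⊢ ¬' φ ∶ ⊖
  neg⊖  : ∀ {φ} → Γ ⊢ φ ∶ ⊖ → Γ ⊢ ¬' φ ∶ ⊕
  next  : ∀ {φ α} → Γ ⊢ φ ∶ α → Γ ⊢ X' φ ∶ α
  prev  : ∀ {φ α} → Γ ⊢ φ ∶ α → Γ ⊢ Y' φ ∶ α
  and   : ∀ {φ ψ α} → Γ ⊢ φ ∶ α → Γ ⊢ ψ ∶ α → Γ ⊢ φ ∧' ψ ∶ α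
  until : ∀ {φ ψ α} → Γ ⊢ φ ∶ α → Γ ⊢ ψ ∶ α → Γ ⊢ φ U' ψ ∶ α
  since : ∀ {φ ψ α} → Γ ⊢ φ ∶ α → Γ ⊢ ψ ∶ α → Γ ⊢ φ S' ψ ∶ α
  exists⊕ : ∀ {π X φ} → X ∈ₗ Γ → Γ ⊢ φ ∶ ⊕ → Γ ⊢ qtrace ∃q π X φ ∶ ⊕
  forall⊖ : ∀ {π X φ} → X ∈ₗ Γ → Γ ⊢ φ ∶ ⊖ → Γ ⊢ qtrace ∀q π X φ ∶ ⊖
  fixR  : ∀ {X ξs φ α} → (X ∷ Γ) ⊢ φ ∶ α → Γ ⊢ fix X ξs φ ∶ α
  qsetR : ∀ {Q X φ α} → Γ ⊢ φ ∶ α → Γ ⊢ qset Q X φ ∶ α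

{-# OPTIONS --safe #-}
-- By induction on the derivation: a formula of polarity ⊕ stays true when
-- the system and all set variables grow together, one of polarity ⊖ when
-- they shrink together, and negation swaps the two.  A
-- quantified subset of one system is matched by itself or by its
-- intersection with the other system.  For fix, the least solution exists:
-- it is the set of inductively derivable traces, which satisfies every
-- clause because closedness binds the clause's target trace.  Least
-- solutions grow with the outer set variables, since clauses are antitone
-- in the sets their binders range over.
module Submission where

open import Defs
open import Data.Nat using (ℕ; zero; suc; _≟_)
open import Data.Nat.Properties using (≟-diag)
open import Data.List using (List; []; _∷_)
open import Data.List.Membership.Propositional renaming (_∈_ to _∈ₗ_)
open import Data.List.Relation.Unary.Any using (here; there)
import Data.List.Relation.Unary.All as All
open All using (All)
open import Data.Product using (_×_; _,_; proj₁; proj₂; ∃-syntax)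
open import Data.Maybe using (Maybe; just; nothing)
open import Data.Empty using (⊥; ⊥-elim)
open import Level using (lift; lower)
open import Relation.Nullary using (yes; no)
open import Relation.Binary.PropositionalEquality using (_≡_; _≢_; refl; sym; subst)

private
  variable
    k m i : ℕ
    X Y : SVar
    A A' L L' T T' : TSet k m
    Π : TAssign k m
    Δ Δ' : SAssign k m
    ξs : List (Clause k)

_⊆ₛ_ : SAssign k m → SAssign k m → Set
Δ ⊆ₛ Δ' = ∀ Y → Δ Y ⊆ₜ Δ' Y

updated : (Δ : SAssign k m) (X : SVar) → (Δ [ X ↦ₛ A ]) X ≡ A
updated Δ X rewrite ≟-diag (refl {x = X}) = refl

∈-updated : (Δ : SAssign k m) (X : SVar) → A ⊆ₜ (Δ [ X ↦ₛ A ]) X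
∈-updated Δ X t = subst (λ B → B t) (sym (updated Δ X))

∈-updated⁻ : (Δ : SAssign k m) (X : SVar) → (Δ [ X ↦ₛ A ]) X ⊆ₜ A
∈-updated⁻ Δ X t = subst (λ B → B t) (updated Δ X)

∈-not-updated : (Δ : SAssign k m) → Y ≢ X → Δ Y ⊆ₜ (Δ [ X ↦ₛ A ]) Y
∈-not-updated {Y = Y} {X = X} Δ Y≢X t with Y ≟ X
... | yes Y≡X = ⊥-elim (Y≢X Y≡X)
... | no _ = λ Δt → Δt

update-mono : Δ ⊆ₛ Δ' → A ⊆ₜ A' → (Δ [ X ↦ₛ A ]) ⊆ₛ (Δ' [ X ↦ₛ A' ])
update-mono {X = X} Δ⊆Δ' A⊆A' Y with Y ≟ X
... | yes _ = A⊆A'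
... | no _ = Δ⊆Δ' Y

Assigned : List TVar → TAssign k m → Set
Assigned tv Π = ∀ {ρ} → ρ ∈ₗ tv → ∃[ t ] (Π ρ ≡ just t)

Assigned-extend : ∀ {tv} π t → Assigned tv Π → Assigned (π ∷ tv) (Π [ π ↦ₜ t ])
Assigned-extend π t assigned {ρ} ρ∈ with ρ ≟ π
... | yes _ = t , refl
Assigned-extend π t assigned (here ρ≡π) | no ρ≢π = ⊥-elim (ρ≢π ρ≡π)
Assigned-extend π t assigned (there ρ∈) | no _ = assigned ρ∈

InSet-mono : (mt : Maybe (Trace k m)) → A ⊆ₜ A' → InSet mt A → InSet mt A'
InSet-mono nothing _ ()
InSet-mono (just t) A⊆A' = A⊆A' t

binders-antitone : ∀ {D D' : SAssign k m} {bs φ π} {Π' : TAssign k m} →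
  D ⊆ₛ D' → D' X ⊆ₜ D X →
  BindersHold X bs φ π Π' D' i → BindersHold X bs φ π Π' D i
binders-antitone {bs = []} {π = π} {Π'} D⊆D' D'X⊆DX hold φ-holds =
  InSet-mono (Π' π) D'X⊆DX (hold φ-holds)
binders-antitone {bs = (_ , Xₗ) ∷ _} D⊆D' D'X⊆DX hold t t∈ =
  binders-antitone D⊆D' D'X⊆DX (hold t (D⊆D' Xₗ t t∈))

clauses-antitone : ∀ {D D' : SAssign k m} →
  D ⊆ₛ D' → D' X ⊆ₜ D X → AllClausesHold X ξs Π D' i → AllClausesHold X ξs Π D i
clauses-antitone D⊆D' D'X⊆DX = All.map (binders-antitone D⊆D' D'X⊆DX)

IsLeast : SVar → List (Clause k) → TAssign k m → SAssign k m → ℕ → TSet k m → Set₁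
IsLeast X ξs Π Δ i L =
  AllClausesHold X ξs Π (Δ [ X ↦ₛ L ]) i ×
  (∀ A → AllClausesHold X ξs Π (Δ [ X ↦ₛ A ]) i → L ⊆ₜ A)

least-mono : Δ ⊆ₛ Δ' → IsLeast X ξs Π Δ i L → IsLeast X ξs Π Δ' i L' → L ⊆ₜ L'
least-mono {Δ = Δ} {Δ' = Δ'} {X = X} {L' = L'} Δ⊆Δ' (_ , L-least) (L'-solves , _) =
  L-least L' (clauses-antitone (update-mono Δ⊆Δ' (λ _ Lt → Lt)) at-X L'-solves)
  where
  at-X : (Δ' [ X ↦ₛ L' ]) X ⊆ₜ (Δ [ X ↦ₛ L' ]) X
  at-X t L't = ∈-updated Δ X t (∈-updated⁻ Δ' X t L't)

module LeastSolution (X : SVar) (ξs : List (Clause k)) (Π : TAssign k m)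
                     (Δ : SAssign k m) (i : ℕ) where

  data Derivable : Trace k m → Set
  data Produces : List (TVar × SVar) → QF k → TVar → TAssign k m → Trace k m → Set
  -- Available Y is (Δ [ X ↦ₛ Derivable ]) Y, spelled out so that the
  -- mutual definition is strictly positive.
  data Available : SVar → Trace k m → Set

  data Derivable where
    fire : ∀ {ξ t} → ξ ∈ₗ ξs →
           Produces (Clause.binders ξ) (Clause.step ξ) (Clause.target ξ) Π t → Derivable t

  data Produces where
    done : ∀ {φ π Π' t} → ⟦ φ ⟧q Π' i → Π' π ≡ just t → Produces [] φ π Π' t
    bind : ∀ {πₗ Xₗ bs φ π Π' t} u → Available Xₗ u →
           Produces bs φ π (Π' [ πₗ ↦ₜ u ]) t → Produces ((πₗ , Xₗ) ∷ bs) φ π Π' t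

  data Available where
    fixed : ∀ {t} → Derivable t → Available X t
    outer : ∀ {Y t} → Y ≢ X → Δ Y t → Available Y t

  available : ∀ Y t → (Δ [ X ↦ₛ Derivable ]) Y t → Available Y t
  available Y t with Y ≟ X
  ... | yes refl = fixed
  ... | no Y≢X = outer Y≢X

  binders-hold : ∀ {sv tv bs φ π Π'} →
    ScopedBinders X sv tv bs φ π → Assigned tv Π' → Produces bs φ π Π' ⊆ₜ Derivable →
    BindersHold X bs φ π Π' (Δ [ X ↦ₛ Derivable ]) i
  binders-hold (done _ π∈) assigned produced φ-holds with assigned π∈
  ... | t , Π'π≡t rewrite Π'π≡t = ∈-updated Δ X t (produced t (done φ-holds Π'π≡t))
  binders-hold (bind _ scoped) assigned produced u u∈ =
    binders-hold scoped (Assigned-extend _ u assigned)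
      (λ t p → produced t (bind u (available _ u u∈) p))

  module _ (A : TSet k m) (A-solves : AllClausesHold X ξs Π (Δ [ X ↦ₛ A ]) i) where
    derivable-least : Derivable ⊆ₜ A
    produces-least : ∀ {bs φ π Π'} → BindersHold X bs φ π Π' (Δ [ X ↦ₛ A ]) i →
                     Produces bs φ π Π' ⊆ₜ A
    available-least : ∀ Y → Available Y ⊆ₜ (Δ [ X ↦ₛ A ]) Y

    derivable-least t (fire ξ∈ p) = produces-least (All.lookup A-solves ξ∈) t p
    produces-least hold t (done φ-holds Π'π≡t) with hold φ-holds
    ... | Π'π∈A rewrite Π'π≡t = ∈-updated⁻ Δ X t Π'π∈A
    produces-least hold t (bind u u∈ p) = produces-least (hold u (available-least _ u u∈)) t p
    available-least _ t (fixed d) = ∈-updated Δ X t (derivable-least t d)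
    available-least _ t (outer Y≢X Δt) = ∈-not-updated Δ Y≢X t Δt

  derivable-solves : ∀ {tv sv} → All (ScopedClause X tv sv) ξs → Assigned tv Π →
                     AllClausesHold X ξs Π (Δ [ X ↦ₛ Derivable ]) i
  derivable-solves scoped assigned =
    All.tabulate λ ξ∈ → binders-hold (All.lookup scoped ξ∈) assigned (λ _ → fire ξ∈)

_⊑_ : TSet k m × SAssign k m → TSet k m × SAssign k m → Set
(T , Δ) ⊑ (T' , Δ') = T ⊆ₜ T' × Δ ⊆ₛ Δ'

_⊑⟨_⟩_ : TSet k m × SAssign k m → Pol → TSet k m × SAssign k m → Set
E ⊑⟨ ⊕ ⟩ E' = E ⊑ E'
E ⊑⟨ ⊖ ⟩ E' = E' ⊑ E

pull-subset : ∀ α → (T , Δ) ⊑⟨ α ⟩ (T' , Δ') → A' ⊆ₜ T' →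
  ∃[ A ] (A ⊆ₜ T × (T , Δ [ X ↦ₛ A ]) ⊑⟨ α ⟩ (T' , Δ' [ X ↦ₛ A' ]))
pull-subset {T = T} {A' = A'} ⊕ (T⊆T' , Δ⊆Δ') A'⊆T' =
  (λ t → A' t × T t) , (λ _ → proj₂) , T⊆T' , update-mono Δ⊆Δ' (λ _ → proj₁)
pull-subset {A' = A'} ⊖ (T'⊆T , Δ'⊆Δ) A'⊆T' =
  A' , (λ t A't → T'⊆T t (A'⊆T' t A't)) , T'⊆T , update-mono Δ'⊆Δ (λ _ A't → A't)

push-subset : ∀ α → (T , Δ) ⊑⟨ α ⟩ (T' , Δ') → A ⊆ₜ T →
  ∃[ A' ] (A' ⊆ₜ T' × (T , Δ [ X ↦ₛ A ]) ⊑⟨ α ⟩ (T' , Δ' [ X ↦ₛ A' ]))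
push-subset {A = A} ⊕ (T⊆T' , Δ⊆Δ') A⊆T =
  A , (λ t At → T⊆T' t (A⊆T t At)) , T⊆T' , update-mono Δ⊆Δ' (λ _ At → At)
push-subset {T' = T'} {A = A} ⊖ (T'⊆T , Δ'⊆Δ) A⊆T =
  (λ t → A t × T' t) , (λ _ → proj₂) , T'⊆T , update-mono Δ'⊆Δ (λ _ → proj₁)

least-related : ∀ α → (T , Δ) ⊑⟨ α ⟩ (T' , Δ') →
  IsLeast X ξs Π Δ i L → IsLeast X ξs Π Δ' i L' →
  (T , Δ [ X ↦ₛ L ]) ⊑⟨ α ⟩ (T' , Δ' [ X ↦ₛ L' ])
least-related ⊕ (T⊆T' , Δ⊆Δ') L-least L'-least =
  T⊆T' , update-mono Δ⊆Δ' (least-mono Δ⊆Δ' L-least L'-least)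
least-related ⊖ (T'⊆T , Δ'⊆Δ) L-least L'-least =
  T'⊆T , update-mono Δ'⊆Δ (least-mono Δ'⊆Δ L'-least L-least)

preserves : ∀ {Γ} {φ : Formula k} {α tv sv} →
  Γ ⊢ φ ∶ α → Scoped tv sv φ → Assigned tv Π →
  (T , Δ) ⊑⟨ α ⟩ (T' , Δ') → ⟦ φ ⟧ T Π Δ i → ⟦ φ ⟧ T' Π Δ' i
preserves atom⊕ _ _ _ holds = holds
preserves atom⊖ _ _ _ holds = holds
preserves (neg⊕ ⊢φ) (¬' sφ) assigned rel ¬holds holds' =
  ¬holds (preserves ⊢φ sφ assigned rel holds')
preserves (neg⊖ ⊢φ) (¬' sφ) assigned rel ¬holds holds' =
  ¬holds (preserves ⊢φ sφ assigned rel holds')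
preserves (next ⊢φ) (X' sφ) assigned rel (i+1<m , holds) =
  i+1<m , preserves ⊢φ sφ assigned rel holds
preserves {i = zero} (prev ⊢φ) (Y' sφ) assigned rel ()
preserves {i = suc _} (prev ⊢φ) (Y' sφ) assigned rel holds =
  preserves ⊢φ sφ assigned rel holds
preserves (and ⊢φ ⊢ψ) (sφ ∧' sψ) assigned rel (φ-holds , ψ-holds) =
  preserves ⊢φ sφ assigned rel φ-holds , preserves ⊢ψ sψ assigned rel ψ-holds
preserves (until ⊢φ ⊢ψ) (sφ U' sψ) assigned rel (j , bounds , ψ-holds , φ-holds) =
  j , bounds , preserves ⊢ψ sψ assigned rel ψ-holds ,
  λ l i≤l l<j → preserves ⊢φ sφ assigned rel (φ-holds l i≤l l<j)
preserves (since ⊢φ ⊢ψ) (sφ S' sψ) assigned rel (j , bounds , ψ-holds , φ-holds) =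
  j , bounds , preserves ⊢ψ sψ assigned rel ψ-holds ,
  λ l j<l l≤i → preserves ⊢φ sφ assigned rel (φ-holds l j<l l≤i)
preserves (exists⊕ {π = π} {X} _ ⊢φ) (qtrace _ sφ) assigned rel@(_ , Δ⊆Δ')
          (t , lift t∈ , holds) =
  t , lift (Δ⊆Δ' X t t∈) , preserves ⊢φ sφ (Assigned-extend π t assigned) rel holds
preserves (forall⊖ {π = π} {X} _ ⊢φ) (qtrace _ sφ) assigned rel@(_ , Δ'⊆Δ)
          holds t t∈ =
  preserves ⊢φ sφ (Assigned-extend π t assigned) rel (holds t (Δ'⊆Δ X t t∈))
preserves {α = α} (qsetR {Q = ∀q} ⊢φ) (qset sφ) assigned rel holds A' A'⊆T' =
  let A , A⊆T , rel' = pull-subset α rel A'⊆T' in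
  preserves ⊢φ sφ assigned rel' (holds A A⊆T)
preserves {α = α} (qsetR {Q = ∃q} ⊢φ) (qset sφ) assigned rel (A , lift A⊆T , holds) =
  let A' , A'⊆T' , rel' = push-subset α rel A⊆T in
  A' , lift A'⊆T' , preserves ⊢φ sφ assigned rel' holds
preserves {Π = Π} {T = T} {Δ = Δ} {T' = T'} {Δ' = Δ'} {i = i} {α = α} (fixR {X = X} {ξs} ⊢φ)
          (fix scoped sφ) assigned rel (L , lift L-solves , L-least , holds) =
  Derivable , lift Derivable-solves , (λ A A-solves → lift (derivable-least A A-solves)) ,
  preserves ⊢φ sφ assigned rel' holds
  where
  open LeastSolution X ξs Π Δ' i
  L-isLeast : IsLeast X ξs Π Δ i L
  L-isLeast = L-solves , λ A A-solves → lower (L-least A A-solves)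
  Derivable-solves : AllClausesHold X ξs Π (Δ' [ X ↦ₛ Derivable ]) i
  Derivable-solves = derivable-solves scoped assigned
  rel' : (T , Δ [ X ↦ₛ L ]) ⊑⟨ α ⟩ (T' , Δ' [ X ↦ₛ Derivable ])
  rel' = least-related α rel L-isLeast (Derivable-solves , derivable-least)

initial-⊑ : T ⊆ₜ T' →
  (T , (λ _ _ → ⊥) [ sys ↦ₛ T ]) ⊑ (T' , (λ _ _ → ⊥) [ sys ↦ₛ T' ])
initial-⊑ T⊆T' = T⊆T' , update-mono (λ _ _ ()) T⊆T'

proposition4p4 : ∀ {k : ℕ} (φ : Formula k) → Closed φ →
    ((sys ∷ []) ⊢ φ ∶ ⊕ → ⊕-monotone φ) × ((sys ∷ []) ⊢ φ ∶ ⊖ → ⊖-monotone φ)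
proposition4p4 φ closed =
  (λ ⊢φ m T T' T⊆T' → preserves ⊢φ closed (λ ()) (initial-⊑ T⊆T')) ,
  (λ ⊢φ m T T' T⊆T' T⊭φ T'⊨φ → T⊭φ (preserves ⊢φ closed (λ ()) (initial-⊑ T⊆T') T'⊨φ))
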